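{- Let $L\subseteq\mathcal{L}$ be a finite signature and $i\in\mathbb{I}(L)$. Then $i\downarrow$ holds if and only if $\varepsilon_L\in\sigma_{|L}(i)$.
   Context: Fix a universe $\mathcal{L}$ of lifelines and a universe $\mathcal{M}$ of messages. For $l\in\mathcal{L}$, $\mathbb{A}_l=\{l!m,\ l?m\mid m\in\mathcal{M}\}$ and $\mathbb{T}_l=\mathbb{A}_l^*$. Multi-traces: for finite $L$, $\mathbb{A}(L)=\bigcup_{l\in L}\mathbb{A}_l$ and $\mathbb{M}(L)=\prod_{l\in L}\mathbb{T}_l$, with empty multi-trace $\varepsilon_L$. For $a\in\mathbb{A}_l$, $a\,\hat{}\,\varepsilon_L$ has $l$-component $a$ and all other components empty. Operations on multi-traces: - $\mu_1\cup\mu_2=\{\mu_1,\mu_2\}$. - $\mu_1;\mu_2$ is the componentwise concatenation. - $\mu_1\,||\,\mu_2$ is the set of $\mu$ such that each component of $\mu$ is a shuffle of the corresponding components of $\mu_1$ and $\mu_2$. These are extended to sets via unions over pairs. For $\diamond\in\{;,||\}$, $T^{\diamond*}=\bigcup_{j\ge0}T^{\diamond j}$, with $T^{\diamond0}=\{\varepsilon_L\}$ and $T^{\diamond j}=T\diamond T^{\diamond(j-1)}$. Interactions: $\mathbb{I}(L)$ is the set of ground terms built from $\varnothing$, actions $a\in\mathbb{A}(L)$, the unary operators $loop_S,loop_P$ and the binary operators $seq,par,alt$. Semantics $\sigma_{|L}$: - $\sigma_{|L}(\varnothing)=\{\varepsilon_L\}$ and $\sigma_{|L}(a)=\{a\,\hat{}\,\varepsilon_L\}$;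 - $seq$, $par$, $alt$ are interpreted by $;$, $||$, $\cup$; - $loop_S$, $loop_P$ are interpreted by ${}^{;*}$, ${}^{||*}$. Termination predicate $\downarrow\subseteq\mathbb{I}(L)$: it is the smallest predicate such that - $\varnothing\downarrow$; - $loop_k(i_1)\downarrow$ for $k\in\{S,P\}$; - $alt(i_1,i_2)\downarrow$ if $i_1\downarrow$ or $i_2\downarrow$; - $f(i_1,i_2)\downarrow$ for $f\in\{seq,par\}$ if $i_1\downarrow$ and $i_2\downarrow$. In particular, no action $a$ satisfies $a\downarrow$. -}

module Defs where

open import Data.Nat using (ℕ)
open import Data.Fin using (Fin)
open import Data.Vec using (Vec; lookup; replicate; zipWith; _[_]≔_)
import Data.Vec as Vec
open import Data.Sum using (_⊎_)
open import Data.Vec.Relation.Binary.Pointwise.Inductive using (Pointwise)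
open import Data.List using (List; []; _∷_; _++_)
open import Data.List.Relation.Ternary.Interleaving.Propositional using (Interleaving)
open import Data.Product using (_×_; ∃; ∃-syntax; _,_)
open import Relation.Binary.PropositionalEquality using (_≡_)

data Dir : Set where
  emit recv : Dir

-- A finite signature L ⊆ 𝓛 is a duplicate-free vector of lifelines
-- (uniqueness is imposed in the statement); lifeline (lookup L k) is
-- referred to by its position k : Fin n.
-- Actions on a fixed lifeline l : l!m / l?m, represented as (Dir × 𝓜)
-- (the lifeline tag l is implicit in the component where it occurs).
LAct : Set → Set
LAct 𝓜 = Dir × 𝓜

Trace : Set → Set
Trace 𝓜 = List (LAct 𝓜)

-- Multi-traces 𝕄(L) = ∏_{l∈L} 𝕋_l  (component k = lifeline lookup L k)
-- (it depends on L only through its size n)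
MultiTrace : (𝓜 : Set) → ℕ → Set
MultiTrace 𝓜 n = Vec (Trace 𝓜) n

ε : ∀ {𝓛 𝓜 : Set} {n : ℕ} (L : Vec 𝓛 n) → MultiTrace 𝓜 n
ε {n = n} L = replicate n []

_^ε : ∀ {𝓜 : Set} {n : ℕ} → (Fin n × LAct 𝓜) → MultiTrace 𝓜 n
_^ε {n = n} (k , a) = replicate n [] [ k ]≔ (a ∷ [])

_⨾_ : ∀ {𝓜 : Set} {n : ℕ} → MultiTrace 𝓜 n → MultiTrace 𝓜 n → MultiTrace 𝓜 n
μ₁ ⨾ μ₂ = zipWith _++_ μ₁ μ₂

data ParShuffle {𝓜 : Set} : ∀ {n : ℕ} → Vec (Trace 𝓜) n → Vec (Trace 𝓜) n → Vec (Trace 𝓜) n → Set where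
  []  : ParShuffle Vec.[] Vec.[] Vec.[]
  _∷_ : ∀ {n} {t₁ t₂ t : Trace 𝓜} {v₁ v₂ v : Vec (Trace 𝓜) n}
        → Interleaving t₁ t₂ t → ParShuffle v₁ v₂ v
        → ParShuffle (t₁ Vec.∷ v₁) (t₂ Vec.∷ v₂) (t Vec.∷ v)

data Interaction {𝓛 : Set} (𝓜 : Set) {n : ℕ} (L : Vec 𝓛 n) : Set where
  ∅     : Interaction 𝓜 L
  act   : Fin n → LAct 𝓜 → Interaction 𝓜 L
  loopS : Interaction 𝓜 L → Interaction 𝓜 L
  loopP : Interaction 𝓜 L → Interaction 𝓜 L
  seq   : Interaction 𝓜 L → Interaction 𝓜 L → Interaction 𝓜 L
  par   : Interaction 𝓜 L → Interaction 𝓜 L → Interaction 𝓜 L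
  alt   : Interaction 𝓜 L → Interaction 𝓜 L → Interaction 𝓜 L

MTSet : (𝓜 : Set) → ℕ → Set₁
MTSet 𝓜 n = MultiTrace 𝓜 n → Set

-- T^{;*} = ⋃_j T^{;j}, with T^{;0} = {ε}, T^{;j} = T ; T^{;(j-1)}
data SeqStar {𝓜 : Set} {n : ℕ} (T : MTSet 𝓜 n) : MTSet 𝓜 n where
  none : SeqStar T (replicate n [])
  more : ∀ {μ₁ μ₂} → T μ₁ → SeqStar T μ₂ → SeqStar T (μ₁ ⨾ μ₂)

data ParStar {𝓜 : Set} {n : ℕ} (T : MTSet 𝓜 n) : MTSet 𝓜 n where
  none : ParStar T (replicate n [])
  more : ∀ {μ₁ μ₂ μ} → T μ₁ → ParStar T μ₂ → ParShuffle μ₁ μ₂ μ → ParStar T μ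

σ : ∀ {𝓛 𝓜 : Set} {n : ℕ} {L : Vec 𝓛 n} → Interaction 𝓜 L → MTSet 𝓜 n
σ {L = L} ∅ μ = μ ≡ ε L
σ (act k a) μ = μ ≡ (k , a) ^ε
σ (loopS i) μ = SeqStar (σ i) μ
σ (loopP i) μ = ParStar (σ i) μ
σ (seq i₁ i₂) μ = ∃[ μ₁ ] ∃[ μ₂ ] (σ i₁ μ₁ × σ i₂ μ₂ × μ ≡ μ₁ ⨾ μ₂)
σ (par i₁ i₂) μ = ∃[ μ₁ ] ∃[ μ₂ ] (σ i₁ μ₁ × σ i₂ μ₂ × ParShuffle μ₁ μ₂ μ)
σ (alt i₁ i₂) μ = σ i₁ μ ⊎ σ i₂ μ

data _↓ {𝓛 𝓜 : Set} {n : ℕ} {L : Vec 𝓛 n} : Interaction 𝓜 L → Set where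
  ∅↓     : ∅ ↓
  loopS↓ : ∀ {i} → loopS i ↓
  loopP↓ : ∀ {i} → loopP i ↓
  altˡ↓  : ∀ {i₁ i₂} → i₁ ↓ → alt i₁ i₂ ↓
  altʳ↓  : ∀ {i₁ i₂} → i₂ ↓ → alt i₁ i₂ ↓
  seq↓   : ∀ {i₁ i₂} → i₁ ↓ → i₂ ↓ → seq i₁ i₂ ↓
  par↓   : ∀ {i₁ i₂} → i₁ ↓ → i₂ ↓ → par i₁ i₂ ↓

{-# OPTIONS --safe #-}
module Submission where

open import Defs
open import Data.Nat using (ℕ; zero; suc)
open import Data.Fin using (Fin)
open import Data.List using ([]; _∷_; _++_)
open import Data.List.Properties using (++-conicalˡ; ++-conicalʳ)
import Data.List.Relation.Ternary.Interleaving as Interleaving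
open import Data.Vec using (Vec; replicate; lookup; _∷_)
open import Data.Vec.Properties using (∷-injective; zipWith-replicate; lookup-replicate; lookup∘update)
open import Data.Vec.Relation.Unary.Unique.Propositional using (Unique)
open import Data.Product using (_×_; _,_)
open import Data.Sum using (inj₁; inj₂)
open import Function.Bundles using (_⇔_; mk⇔)
open import Relation.Binary.PropositionalEquality
open import Relation.Nullary using (¬_)

-- We have ε ; ε = ε and ε ∈ ε || ε, and
-- both operations are conical: they yield ε only from ε and ε.  Hence
-- ε ∈ σ(i) propagates through the operators exactly as ↓ does, while a
-- single action never denotes ε and the loops always contain ε (zero
-- iterations).

module _ {𝓜 : Set} where

  ε′ : (n : ℕ) → MultiTrace 𝓜 n
  ε′ n = replicate n []

  ⨾-idem-ε : ∀ n → ε′ n ⨾ ε′ n ≡ ε′ n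
  ⨾-idem-ε n = zipWith-replicate _++_ [] []

  ⨾-conical : ∀ {n} (μ₁ μ₂ : MultiTrace 𝓜 n) → μ₁ ⨾ μ₂ ≡ ε′ n → μ₁ ≡ ε′ n × μ₂ ≡ ε′ n
  ⨾-conical Vec.[] Vec.[] _ = refl , refl
  ⨾-conical (t₁ ∷ μ₁) (t₂ ∷ μ₂) eq
    with ∷-injective eq
  ... | t₁++t₂≡[] , rest≡ε
    with ⨾-conical μ₁ μ₂ rest≡ε
  ... | μ₁≡ε , μ₂≡ε =
    cong₂ _∷_ (++-conicalˡ t₁ t₂ t₁++t₂≡[]) μ₁≡ε ,
    cong₂ _∷_ (++-conicalʳ t₁ t₂ t₁++t₂≡[]) μ₂≡ε

  ParShuffle-ε : ∀ n → ParShuffle (ε′ n) (ε′ n) (ε′ n)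
  ParShuffle-ε zero = []
  ParShuffle-ε (suc n) = Interleaving.[] ∷ ParShuffle-ε n

  ParShuffle-conical : ∀ {n} {μ₁ μ₂ : MultiTrace 𝓜 n} → ParShuffle μ₁ μ₂ (ε′ n) → μ₁ ≡ ε′ n × μ₂ ≡ ε′ n
  ParShuffle-conical [] = refl , refl
  ParShuffle-conical (Interleaving.[] ∷ ps) with ParShuffle-conical ps
  ... | μ₁≡ε , μ₂≡ε = cong ([] ∷_) μ₁≡ε , cong ([] ∷_) μ₂≡ε

  ^ε≢ε : ∀ {n} (k : Fin n) (a : LAct 𝓜) → ¬ (ε′ n ≡ (k , a) ^ε)
  ^ε≢ε {n} k a eq with begin
      []                       ≡⟨ lookup-replicate k [] ⟨
      lookup (ε′ n) k          ≡⟨ cong (λ μ → lookup μ k) eq ⟩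
      lookup ((k , a) ^ε) k    ≡⟨ lookup∘update k (ε′ n) (a ∷ []) ⟩
      a ∷ []                   ∎
    where open ≡-Reasoning
  ... | ()

module _ {𝓛 𝓜 : Set} {n : ℕ} {L : Vec 𝓛 n} where

  ↓⇒ε∈σ : (i : Interaction 𝓜 L) → i ↓ → σ i (ε L)
  ↓⇒ε∈σ ∅ ∅↓ = refl
  ↓⇒ε∈σ (loopS i) loopS↓ = none
  ↓⇒ε∈σ (loopP i) loopP↓ = none
  ↓⇒ε∈σ (alt i₁ i₂) (altˡ↓ i₁↓) = inj₁ (↓⇒ε∈σ i₁ i₁↓)
  ↓⇒ε∈σ (alt i₁ i₂) (altʳ↓ i₂↓) = inj₂ (↓⇒ε∈σ i₂ i₂↓)
  ↓⇒ε∈σ (seq i₁ i₂) (seq↓ i₁↓ i₂↓) =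
    ε L , ε L , ↓⇒ε∈σ i₁ i₁↓ , ↓⇒ε∈σ i₂ i₂↓ , sym (⨾-idem-ε n)
  ↓⇒ε∈σ (par i₁ i₂) (par↓ i₁↓ i₂↓) =
    ε L , ε L , ↓⇒ε∈σ i₁ i₁↓ , ↓⇒ε∈σ i₂ i₂↓ , ParShuffle-ε n

  ε∈σ⇒↓ : (i : Interaction 𝓜 L) → σ i (ε L) → i ↓
  ε∈σ⇒↓ ∅ _ = ∅↓
  ε∈σ⇒↓ (act k a) ε≡a^ε with () ← ^ε≢ε k a ε≡a^ε
  ε∈σ⇒↓ (loopS i) _ = loopS↓
  ε∈σ⇒↓ (loopP i) _ = loopP↓
  ε∈σ⇒↓ (alt i₁ i₂) (inj₁ ε∈σi₁) = altˡ↓ (ε∈σ⇒↓ i₁ ε∈σi₁)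
  ε∈σ⇒↓ (alt i₁ i₂) (inj₂ ε∈σi₂) = altʳ↓ (ε∈σ⇒↓ i₂ ε∈σi₂)
  ε∈σ⇒↓ (seq i₁ i₂) (μ₁ , μ₂ , μ₁∈σi₁ , μ₂∈σi₂ , ε≡μ₁⨾μ₂)
    with refl , refl ← ⨾-conical μ₁ μ₂ (sym ε≡μ₁⨾μ₂) =
    seq↓ (ε∈σ⇒↓ i₁ μ₁∈σi₁) (ε∈σ⇒↓ i₂ μ₂∈σi₂)
  ε∈σ⇒↓ (par i₁ i₂) (μ₁ , μ₂ , μ₁∈σi₁ , μ₂∈σi₂ , shuffle)
    with refl , refl ← ParShuffle-conical shuffle =
    par↓ (ε∈σ⇒↓ i₁ μ₁∈σi₁) (ε∈σ⇒↓ i₂ μ₂∈σi₂)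

lemma1 : ∀ {𝓛 𝓜 : Set} {n : ℕ} (L : Vec 𝓛 n) → Unique L
    → (i : Interaction 𝓜 L) → (i ↓) ⇔ σ i (ε L)
lemma1 L _ i = mk⇔ (↓⇒ε∈σ i) (ε∈σ⇒↓ i)
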